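{- Let $X$ be a sock ordering, let $b$ be a color of $X$, and write $X=AbC$ where the displayed $b$ is the final sock of color $b$ in $X$ (so $b\notin C$). Let $\theta$ be a sorting sequence for $X$ that sorts at least one color occurring in $C$, and let $c$ be the first color in $\theta$ that occurs in $C$. Let $(S,R)=\theta(X)$, and suppose $b\in S$ and that, from the moment $c$ has been sorted onward, a sock of color $b$ is never the top sock of the stack. Let $t_0,\dots,t_n$ ($n\ge 0$) be the distinct colors, in order of appearance, that occupy the position immediately above the color $b$ in the stack after $c$ has been sorted (through the end of $\theta$). Then $I(c,t_0,\dots,t_n)\,R\subseteq C$.
   Context: Sock orderings are finite words of colored socks written as words over colors; $Y\subseteq X$ means $Y$ is a subsequence of $X$ (obtained by deleting socks), and $a\in X$ means color $a$ occurs in $X$. A state $(S,R)$ consists of stack content $S$ (left to right = bottom to top) and remaining input $R$; foot-sorting steps push the leftmost sock of $R$ onto the stack or pop the top sock to the output. A sandwich is a word $xyx$ with $x\ne y$; a sandwich $xyx$ blocks a color $z\notin\{x,y\}$ in a word $W$ if $xyxz\subseteq W$. A color $x$ is sortable in $(S,R)$ if (1) no sock of a color other than $x$ lies above a sock of color $x$ in $S$, and (2) if $x$ occurs in $R$, then $x$ is not blocked by any sandwich in $SR$. Sorting a sortable color $x$: pop all socks of color $x$ from the top of $S$ to the output; then, if $x$ occurs in $R$, read $R$ from the left, pushing each sock of another color onto the stack, pushing and immediately popping each non-final sock of color $x$, and pushing and popping the final sock of color $x$, which ends the move. A sorting sequence for $X$ is a sequence $\theta=(a_1,\dots,a_m)$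 of distinct colors of $X$ such that, starting from $(\emptyset,X)$, each $a_i$ is sortable in the state reached after sorting $a_1,\dots,a_{i-1}$; $\theta(X)$ denotes the state reached after sorting all of them. For distinct colors, $I(c)$ is empty and $I(c,t_0,\dots,t_n)=t_0c\,t_1t_0\,t_2t_1\cdots t_nt_{n-1}$ (i.e. $I(s_0,\dots,s_m)=I(s_0,\dots,s_{m-1})s_ms_{m-1}$). -}

module Defs where

open import Data.Nat using (ℕ)
open import Data.Nat.Properties using (_≟_)
open import Data.Product using (_×_; _,_; proj₁; proj₂; ∃; ∃-syntax)
open import Data.Unit using (⊤)
open import Data.List using (List; []; _∷_; _++_; reverse; dropWhile; [_])
open import Data.List.Membership.Propositional using (_∈_; _∉_)
open import Data.List.Membership.DecPropositional _≟_ using (_∈?_)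
open import Data.List.Relation.Binary.Sublist.Propositional using (_⊆_)
open import Relation.Binary.PropositionalEquality using (_≡_; _≢_)
open import Relation.Nullary using (¬_; yes; no)

-- Colors are natural numbers; a sock ordering is a word (list) of colors.
Color : Set
Color = ℕ

Word : Set
Word = List Color

-- A state (S , R): S is the stack, written left to right = bottom to top
-- (so the LAST element of S is the top sock); R is the remaining input.
State : Set
State = Word × Word

Blocks : Color → Color → Color → Word → Set
Blocks x y z W = x ≢ y × z ≢ x × z ≢ y × (x ∷ y ∷ x ∷ z ∷ []) ⊆ W

Sortable : Color → State → Set
Sortable x (S , R) =
  (∀ y → y ≢ x → ¬ ((x ∷ y ∷ []) ⊆ S)) ×
  (x ∈ R → ∀ u v → ¬ Blocks u v x (S ++ R))

popTop : Color → Word → Word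
popTop x S = reverse (dropWhile (_≟ x) (reverse S))

-- read R from the left (assuming x occurs in R): socks of other colors are
-- pushed (collected, in push order), non-final socks of color x are pushed
-- and immediately popped, and the final sock of color x is pushed and popped,
-- ending the move.
readUntilFinal : Color → Word → Word × Word
readUntilFinal x [] = [] , []
readUntilFinal x (y ∷ R) with y ≟ x
... | no _ = let r = readUntilFinal x R in (y ∷ proj₁ r) , proj₂ r
... | yes _ with x ∈? R
...   | yes _ = readUntilFinal x R
...   | no _  = [] , R

sortColor : Color → State → State
sortColor x (S , R) with x ∈? R
... | yes _ = let r = readUntilFinal x R in (popTop x S ++ proj₁ r) , proj₂ r
... | no _  = popTop x S , R

run : State → List Color → State
run st [] = st
run st (a ∷ θ) = run (sortColor a st) θ

trace : State → List Color → List State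
trace st [] = []
trace st (a ∷ θ) = sortColor a st ∷ trace (sortColor a st) θ

SortableFrom : State → List Color → Set
SortableFrom st [] = ⊤
SortableFrom st (a ∷ θ) = Sortable a st × SortableFrom (sortColor a st) θ

open import Data.List.Relation.Unary.Unique.Propositional using (Unique)
open import Data.List.Relation.Unary.All using (All)

SortingSequence : Word → List Color → Set
SortingSequence X θ = Unique θ × All (_∈ X) θ × SortableFrom ([] , X) θ

applySeq : List Color → Word → State
applySeq θ X = run ([] , X) θ

TopNot : Color → Word → Set
TopNot b S = ∀ T → S ≢ T ++ [ b ]

AboveB : Color → Word → Color → Set
AboveB b S t = ∃[ U ] ∃[ V ] (S ≡ U ++ b ∷ t ∷ V × b ∉ t ∷ V)

-- I(c) = empty, I(s₀,…,s_m) = I(s₀,…,s_{m-1}) s_m s_{m-1};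
-- equivalently I(x ∷ y ∷ rest) = y x I(y ∷ rest).
I : List Color → Word
I [] = []
I (x ∷ []) = []
I (x ∷ y ∷ rest) = y ∷ x ∷ I (y ∷ rest)

-- While only colors absent from C are sorted, the final b sock and everything
-- after it stay unread, unless b leaves stack and input for good, which the observation of a
-- color above b rules out.  Sorting c then reads past that b sock up to the final c sock, so
-- the sock t₀ lying on b was read from C before that final c, and t₀ c R ⊆ C for the input R
-- left afterwards.  From then on the color t lying on the b sock changes only when t itself is
-- sorted: the t socks are popped down to b, the next color t′ on b is pushed from the input
-- before the final t sock, so t′ t R′ ⊆ R for the new input R′, and t has disappeared for
-- good.  Hence each color is observed in a single run, which the deduplication accounts for.

module Submission where

open import Defs
open import Level using (Level)
open import Function using (_∘_)
open import Data.Empty using (⊥-elim)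
open import Data.Sum using ([_,_]′)
open import Data.Product using (_×_; _,_; proj₁; proj₂; ∃-syntax)
open import Data.Nat.Properties using (_≟_)
open import Data.List using (List; []; _∷_; _++_; [_]; reverse; dropWhile; filter; deduplicate)
open import Data.List.Properties using (++-identityʳ; ++-assoc; ++-ʳ++; ʳ++-defn; reverse-involutive; ∷-injectiveˡ; ∷-injectiveʳ; filter-reject; filter-idem; filter-all; filter-++; filter-accept)
open import Data.List.Membership.Propositional using (_∈_; _∉_)
open import Data.List.Membership.Propositional.Properties using (∈-++⁺ˡ; ∈-++⁺ʳ; ∈-++⁻; ∈-filter⁻)
open import Data.List.Membership.DecPropositional _≟_ using (_∈?_)
open import Data.List.Relation.Binary.Sublist.Propositional using (_⊆_; _∷_; _∷ʳ_; ⊆-refl; ⊆-trans; ⊆-reflexive; from∈; minimum)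
open import Data.List.Relation.Binary.Sublist.Propositional.Properties using (++⁺; ++⁺ˡ; ++⁺ʳ; reverse⁺; dropWhile-⊆; filter-⊆; Any-resp-⊆)
open import Data.List.Relation.Binary.Pointwise using (Pointwise; []; _∷_)
open import Data.List.Relation.Unary.All as All using (All; []; _∷_)
open import Data.List.Relation.Unary.All.Properties using (deduplicate⁺)
open import Data.List.Relation.Unary.Any using (here; there; any?)
open import Data.List.Relation.Unary.Any.Properties using (reverse⁻)
open import Relation.Binary.Definitions using (DecidableEquality)
open import Relation.Binary.PropositionalEquality using (_≡_; _≢_; refl; sym; trans; cong; subst; module ≡-Reasoning)
open import Relation.Nullary using (¬_; yes; no; ¬?)
open import Relation.Unary using (Pred; Decidable)

private
  variable
    ℓ p : Level
    A : Set ℓ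

module _ {P : Pred A p} (P? : Decidable P) where

  dropWhile-all : ∀ {xs} → All P xs → dropWhile P? xs ≡ []
  dropWhile-all [] = refl
  dropWhile-all {x ∷ _} (px ∷ pxs) with P? x
  ... | yes _ = dropWhile-all pxs
  ... | no ¬px = ⊥-elim (¬px px)

  dropWhile-++-∷ : ∀ xs {y ys} → ¬ P y → dropWhile P? (xs ++ y ∷ ys) ≡ dropWhile P? xs ++ y ∷ ys
  dropWhile-++-∷ [] {y} ¬py with P? y
  ... | yes py = ⊥-elim (¬py py)
  ... | no _ = refl
  dropWhile-++-∷ (x ∷ xs) ¬py with P? x
  ... | yes _ = dropWhile-++-∷ xs ¬py
  ... | no _ = refl

reverse-++-∷ : ∀ (xs : List A) y ys → reverse (xs ++ y ∷ ys) ≡ reverse ys ++ y ∷ reverse xs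
reverse-++-∷ xs y ys = trans (++-ʳ++ xs) (ʳ++-defn ys)

module _ (_≟ᴬ_ : DecidableEquality A) where

  ∈-∃++-last : ∀ {x : A} {xs} → x ∈ xs → ∃[ ys ] ∃[ zs ] xs ≡ ys ++ x ∷ zs × x ∉ zs
  ∈-∃++-last {x = x} {y ∷ xs} x∈ with any? (x ≟ᴬ_) xs
  ... | yes x∈xs = let ys , zs , eq , x∉zs = ∈-∃++-last x∈xs in y ∷ ys , zs , cong (y ∷_) eq , x∉zs
  ... | no x∉xs with x∈
  ...   | here refl = [] , xs , refl , x∉xs
  ...   | there x∈xs = ⊥-elim (x∉xs x∈xs)

  deduplicate-∷-∷ : ∀ (x : A) xs → deduplicate _≟ᴬ_ (x ∷ x ∷ xs) ≡ deduplicate _≟ᴬ_ (x ∷ xs)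
  deduplicate-∷-∷ x xs = cong (x ∷_) (trans
    (filter-reject (¬? ∘ (x ≟ᴬ_)) {xs = filter (¬? ∘ (x ≟ᴬ_)) (deduplicate _≟ᴬ_ xs)} (λ x≢x → x≢x refl))
    (filter-idem (¬? ∘ (x ≟ᴬ_)) (deduplicate _≟ᴬ_ xs)))

  deduplicate-∷-fresh : ∀ {x : A} {xs} → All (x ≢_) xs →
    deduplicate _≟ᴬ_ (x ∷ xs) ≡ x ∷ deduplicate _≟ᴬ_ xs
  deduplicate-∷-fresh {x} x∉xs = cong (x ∷_) (filter-all (¬? ∘ (x ≟ᴬ_)) (deduplicate⁺ _≟ᴬ_ x∉xs))

private
  variable
    a b c t t′ x : Color
    S R C : Word
    st : State
    obs : List Color

OnTop : Color → Word → Set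
OnTop x S = ∀ y → y ≢ x → ¬ (x ∷ y ∷ [] ⊆ S)

Contents : State → Word
Contents (S , R) = S ++ R

otherThan : Color → Word → Word
otherThan x = filter (¬? ∘ (_≟ x))

otherThan-⊆ : ∀ x Q → otherThan x Q ⊆ Q
otherThan-⊆ x = filter-⊆ (¬? ∘ (_≟ x))

x∉otherThan : ∀ Q → x ∉ otherThan x Q
x∉otherThan {x} Q x∈ = proj₂ (∈-filter⁻ (¬? ∘ (_≟ x)) {xs = Q} x∈) refl

OnTop⇒all-after : ∀ {V} → OnTop x S → x ∷ V ⊆ S → All (_≡ x) V
OnTop⇒all-after {x} {V = V} onTop xV⊆S = All.tabulate after
  where
  after : ∀ {v} → v ∈ V → v ≡ x
  after {v} v∈V with v ≟ x
  ... | yes v≡x = v≡x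
  ... | no v≢x = ⊥-elim (onTop v v≢x (⊆-trans (refl ∷ from∈ v∈V) xV⊆S))

popTop-⊆ : ∀ x S → popTop x S ⊆ S
popTop-⊆ x S = subst (popTop x S ⊆_) (reverse-involutive S) (reverse⁺ (dropWhile-⊆ (_≟ x) (reverse S)))

popTop-all : All (_≡ x) S → popTop x S ≡ []
popTop-all {x} S≡x = cong reverse (dropWhile-all (_≟ x) (All.tabulate (All.lookup S≡x ∘ reverse⁻)))

popTop-++-∷ : ∀ L {y} M → y ≢ x → popTop x (L ++ y ∷ M) ≡ L ++ y ∷ popTop x M
popTop-++-∷ {x} L {y} M y≢x = begin
    reverse (dropWhile (_≟ x) (reverse (L ++ y ∷ M)))
  ≡⟨ cong (reverse ∘ dropWhile (_≟ x)) (reverse-++-∷ L y M) ⟩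
    reverse (dropWhile (_≟ x) (reverse M ++ y ∷ reverse L))
  ≡⟨ cong reverse (dropWhile-++-∷ (_≟ x) (reverse M) y≢x) ⟩
    reverse (dropWhile (_≟ x) (reverse M) ++ y ∷ reverse L)
  ≡⟨ reverse-++-∷ (dropWhile (_≟ x) (reverse M)) y (reverse L) ⟩
    reverse (reverse L) ++ y ∷ popTop x M
  ≡⟨ cong (_++ y ∷ popTop x M) (reverse-involutive L) ⟩
    L ++ y ∷ popTop x M
  ∎
  where open ≡-Reasoning

popTop-++-∷-∷ : ∀ U {b t} V → t ≢ x → popTop x (U ++ b ∷ t ∷ V) ≡ U ++ b ∷ t ∷ popTop x V
popTop-++-∷-∷ {x} U {b} {t} V t≢x = begin
  popTop x (U ++ b ∷ t ∷ V)         ≡⟨ cong (popTop x) (sym (++-assoc U [ b ] (t ∷ V))) ⟩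
  popTop x ((U ++ [ b ]) ++ t ∷ V)  ≡⟨ popTop-++-∷ (U ++ [ b ]) V t≢x ⟩
  (U ++ [ b ]) ++ t ∷ popTop x V    ≡⟨ ++-assoc U [ b ] (t ∷ popTop x V) ⟩
  U ++ b ∷ t ∷ popTop x V           ∎
  where open ≡-Reasoning

popTop-++-∷-all : ∀ U {y M} → y ≢ x → All (_≡ x) M → popTop x (U ++ y ∷ M) ≡ U ++ [ y ]
popTop-++-∷-all U {y} {M} y≢x M≡x =
  trans (popTop-++-∷ U M y≢x) (cong (λ T → U ++ y ∷ T) (popTop-all M≡x))

popTop-removes : ∀ S → OnTop x S → x ∉ popTop x S
popTop-removes [] _ ()
popTop-removes {x} (s ∷ S) onTop with s ≟ x
... | yes refl rewrite popTop-all (refl ∷ OnTop⇒all-after onTop ⊆-refl) = λ ()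
... | no s≢x rewrite popTop-++-∷ [] S s≢x = λ
  { (here x≡s) → s≢x (sym x≡s)
  ; (there x∈) → popTop-removes S (λ y y≢x τ → onTop y y≢x (s ∷ʳ τ)) x∈
  }

readUntilFinal-final : ∀ Q {R} → x ∉ R → readUntilFinal x (Q ++ x ∷ R) ≡ (otherThan x Q , R)
readUntilFinal-final {x} [] {R} x∉R with x ≟ x
... | no x≢x = ⊥-elim (x≢x refl)
... | yes refl with x ∈? R
...   | yes x∈R = ⊥-elim (x∉R x∈R)
...   | no _ = refl
readUntilFinal-final {x} (y ∷ Q) {R} x∉R with y ≟ x
... | no y≢x = trans (cong (λ r → y ∷ proj₁ r , proj₂ r) (readUntilFinal-final Q x∉R))
  (cong (_, R) (sym (filter-accept (¬? ∘ (_≟ x)) {xs = Q} y≢x)))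
... | yes refl with x ∈? (Q ++ x ∷ R)
...   | yes _ = trans (readUntilFinal-final Q x∉R)
  (cong (_, R) (sym (filter-reject (¬? ∘ (_≟ x)) {xs = Q} (λ x≢x → x≢x refl))))
...   | no x∉ = ⊥-elim (x∉ (∈-++⁺ʳ Q (here refl)))

sortColor-absent : x ∉ R → sortColor x (S , R) ≡ (popTop x S , R)
sortColor-absent {x} {R} x∉R with x ∈? R
... | yes x∈R = ⊥-elim (x∉R x∈R)
... | no _ = refl

sortColor-final : ∀ Q {R} → x ∉ R → sortColor x (S , Q ++ x ∷ R) ≡ (popTop x S ++ otherThan x Q , R)
sortColor-final {x} Q {R} x∉R with x ∈? (Q ++ x ∷ R)
... | yes _ rewrite readUntilFinal-final Q x∉R = refl
... | no x∉ = ⊥-elim (x∉ (∈-++⁺ʳ Q (here refl)))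

data SortView (x : Color) (S : Word) : Word → State → Set where
  absent : ∀ {R} → x ∉ R → SortView x S R (popTop x S , R)
  final : ∀ Q {R} → x ∉ R → SortView x S (Q ++ x ∷ R) (popTop x S ++ otherThan x Q , R)

sortView : ∀ x S R → SortView x S R (sortColor x (S , R))
sortView x S R with x ∈? R
... | no x∉R = absent x∉R
... | yes x∈R with ∈-∃++-last _≟_ x∈R
...   | Q , R′ , refl , x∉R′ rewrite readUntilFinal-final Q x∉R′ = final Q x∉R′

sortColor-contents-⊆ : ∀ x S R → Contents (sortColor x (S , R)) ⊆ S ++ R
sortColor-contents-⊆ x S R with sortColor x (S , R) | sortView x S R
... | _ | absent _ = ++⁺ (popTop-⊆ x S) ⊆-refl
... | _ | final Q {R′} _ = ⊆-trans (⊆-reflexive (++-assoc (popTop x S) (otherThan x Q) R′))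
  (++⁺ (popTop-⊆ x S) (++⁺ (otherThan-⊆ _ Q) (x ∷ʳ ⊆-refl)))

sortColor-stack : ∀ x S R → ∃[ W ] proj₁ (sortColor x (S , R)) ≡ popTop x S ++ W × W ⊆ R
sortColor-stack x S R with sortColor x (S , R) | sortView x S R
... | _ | absent _ = [] , sym (++-identityʳ (popTop x S)) , minimum R
... | _ | final Q {R′} _ = otherThan x Q , refl , ⊆-trans (otherThan-⊆ _ Q) (++⁺ʳ (x ∷ R′) ⊆-refl)

sortColor-input-⊆ : ∀ x S R → proj₂ (sortColor x (S , R)) ⊆ R
sortColor-input-⊆ x S R with sortColor x (S , R) | sortView x S R
... | _ | absent _ = ⊆-refl
... | _ | final Q _ = ++⁺ˡ Q (x ∷ʳ ⊆-refl)

sortColor-removes : ∀ S R → OnTop x S → x ∉ Contents (sortColor x (S , R))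
sortColor-removes {x} S R onTop with sortColor x (S , R) | sortView x S R
... | _ | absent x∉R = [ popTop-removes S onTop , x∉R ]′ ∘ ∈-++⁻ (popTop x S)
... | _ | final Q {R′} x∉R′ =
  [ [ popTop-removes S onTop , x∉otherThan Q ]′ ∘ ∈-++⁻ (popTop x S) , x∉R′ ]′
  ∘ ∈-++⁻ (popTop x S ++ otherThan x Q)

sortColor-keeps-suffix : ∀ x S A {M} → x ∉ M → ∃[ A′ ] proj₂ (sortColor x (S , A ++ M)) ≡ A′ ++ M
sortColor-keeps-suffix x S A {M} x∉M with x ∈? A
... | no x∉A = A , cong proj₂ (sortColor-absent ([ x∉A , x∉M ]′ ∘ ∈-++⁻ A))
... | yes x∈A with ∈-∃++-last _≟_ x∈A
...   | Q , A′ , refl , x∉A′ = A′ , cong proj₂ (begin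
  sortColor x (S , (Q ++ x ∷ A′) ++ M)  ≡⟨ cong (λ R → sortColor x (S , R)) (++-assoc Q (x ∷ A′) M) ⟩
  sortColor x (S , Q ++ x ∷ A′ ++ M)    ≡⟨ sortColor-final Q ([ x∉A′ , x∉M ]′ ∘ ∈-++⁻ A′) ⟩
  (popTop x S ++ otherThan x Q , A′ ++ M) ∎)
  where open ≡-Reasoning

AboveB⇒∈ : AboveB b S t → t ∈ S
AboveB⇒∈ (U , _ , refl , _) = ∈-++⁺ʳ U (there (here refl))

AboveB⇒b∈ : AboveB b S t → b ∈ S
AboveB⇒b∈ (U , _ , refl , _) = ∈-++⁺ʳ U (here refl)

AboveB-unique : AboveB b S t → AboveB b S t′ → t ≡ t′
AboveB-unique {b = b} {t = t} {t′ = t′} (U , V , refl , b∉tV) (U′ , V′ , eq , b∉t′V′) = same-b U U′ eq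
  where
  same-b : ∀ U U′ → U ++ b ∷ t ∷ V ≡ U′ ++ b ∷ t′ ∷ V′ → t ≡ t′
  same-b [] [] eq = ∷-injectiveˡ (∷-injectiveʳ eq)
  same-b [] (_ ∷ U′) eq =
    ⊥-elim (b∉tV (subst (b ∈_) (sym (∷-injectiveʳ eq)) (∈-++⁺ʳ U′ (here refl))))
  same-b (_ ∷ U) [] eq =
    ⊥-elim (b∉t′V′ (subst (b ∈_) (∷-injectiveʳ eq) (∈-++⁺ʳ U (here refl))))
  same-b (_ ∷ U) (_ ∷ U′) eq = same-b U U′ (∷-injectiveʳ eq)

AboveB-∈-after : ∀ T P → S ≡ T ++ b ∷ P → TopNot b S → AboveB b S t → b ∉ P → t ∈ P
AboveB-∈-after T [] refl topNot _ _ = ⊥-elim (topNot T refl)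
AboveB-∈-after T (s ∷ P) refl _ above b∉sP =
  subst (_∈ s ∷ P) (AboveB-unique (T , P , refl , b∉sP) above) (here refl)

sortColor-keeps-above : a ≢ t → b ∉ R → AboveB b S t → AboveB b (proj₁ (sortColor a (S , R))) t
sortColor-keeps-above {a = a} {t = t} {b = b} {R = R} a≢t b∉R (U , V , refl , b∉tV)
  with W , eq , W⊆R ← sortColor-stack a (U ++ b ∷ t ∷ V) R =
  U , popTop a V ++ W , stack≡ , b∉tV++R ∘ Any-resp-⊆ (refl ∷ ++⁺ (popTop-⊆ a V) W⊆R)
  where
  stack≡ : proj₁ (sortColor a (U ++ b ∷ t ∷ V , R)) ≡ U ++ b ∷ t ∷ popTop a V ++ W
  stack≡ = trans eq
    (trans (cong (_++ W) (popTop-++-∷-∷ U V (a≢t ∘ sym))) (++-assoc U (b ∷ t ∷ popTop a V) W))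
  b∉tV++R : b ∉ t ∷ V ++ R
  b∉tV++R = [ b∉tV , b∉R ]′ ∘ ∈-++⁻ (t ∷ V)

sortColor-replaces-above : OnTop t S → b ∉ R → AboveB b S t →
  TopNot b (proj₁ (sortColor t (S , R))) → AboveB b (proj₁ (sortColor t (S , R))) t′ →
  t′ ∷ t ∷ proj₂ (sortColor t (S , R)) ⊆ R
sortColor-replaces-above {t = t} {b = b} {R = R} {t′ = t′} onTop b∉R (U , V , refl , b∉tV) topNot above′
  with popEq ← popTop-++-∷-all U (b∉tV ∘ here) (refl ∷ OnTop⇒all-after onTop (++⁺ˡ U (b ∷ʳ ⊆-refl)))
     | sortColor t (U ++ b ∷ t ∷ V , R) | sortView t (U ++ b ∷ t ∷ V) R
... | _ | absent _ = ⊥-elim (topNot U popEq)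
... | _ | final Q {R′} _ = ++⁺ (from∈ (Any-resp-⊆ (otherThan-⊆ t Q) t′∈)) ⊆-refl
  where
  t′∈ : t′ ∈ otherThan t Q
  t′∈ = AboveB-∈-after U (otherThan t Q)
    (trans (cong (_++ otherThan t Q) popEq) (++-assoc U [ b ] (otherThan t Q))) topNot above′
    (b∉R ∘ Any-resp-⊆ (⊆-trans (otherThan-⊆ _ Q) (++⁺ʳ (t ∷ R′) ⊆-refl)))

states : State → List Color → List State
states st θ = st ∷ trace st θ

TopNotAt : Color → State → Set
TopNotAt b st = TopNot b (proj₁ st)

AboveAt : Color → State → Color → Set
AboveAt b st t = AboveB b (proj₁ st) t

removed-never-above : ∀ θ → x ∉ Contents st → Pointwise (AboveAt b) (states st θ) obs → All (x ≢_) obs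
removed-never-above {x = x} {st = S , R} θ x∉SR (above ∷ aboves) = x≢ above ∷ later θ aboves
  where
  x≢ : AboveB b S t → x ≢ t
  x≢ above refl = x∉SR (∈-++⁺ˡ (AboveB⇒∈ above))
  later : ∀ θ {obs} → Pointwise (AboveAt b) (trace (S , R) θ) obs → All (x ≢_) obs
  later [] [] = []
  later (a ∷ θ) aboves = removed-never-above θ (x∉SR ∘ Any-resp-⊆ (sortColor-contents-⊆ a S R)) aboves

I-observed-⊆-input : ∀ θ S R → b ∉ R → SortableFrom (S , R) θ →
  All (TopNotAt b) (states (S , R) θ) → Pointwise (AboveAt b) (states (S , R) θ) obs →
  I (deduplicate _≟_ obs) ++ proj₂ (run (S , R) θ) ⊆ R
I-observed-⊆-input [] S R b∉R _ _ (_ ∷ []) = ⊆-refl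
I-observed-⊆-input {b = b} (a ∷ θ) S R b∉R ((onTop , _) , sortable) (_ ∷ topNots@(topNot′ ∷ _))
  (_∷_ {y = t} above aboves@(_∷_ {y = t′} {ys = obs} above′ _))
  with ih ← I-observed-⊆-input θ _ _ (b∉R ∘ Any-resp-⊆ (sortColor-input-⊆ a S R)) sortable topNots aboves
     | a ≟ t
... | no a≢t with refl ← AboveB-unique above′ (sortColor-keeps-above a≢t b∉R above)
  rewrite deduplicate-∷-∷ _≟_ t obs = ⊆-trans ih (sortColor-input-⊆ a S R)
... | yes refl rewrite deduplicate-∷-fresh _≟_ (removed-never-above θ (sortColor-removes S R onTop) aboves) =
  ⊆-trans (refl ∷ refl ∷ ih) (sortColor-replaces-above onTop b∉R above topNot′ above′)

data UnreadOrGone (b : Color) (C : Word) (st : State) : Set where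
  unread : ∀ A → proj₂ st ≡ A ++ b ∷ C → UnreadOrGone b C st
  gone : b ∉ Contents st → UnreadOrGone b C st

sortColor-preserves-UnreadOrGone : x ∉ C → OnTop x S →
  UnreadOrGone b C (S , R) → UnreadOrGone b C (sortColor x (S , R))
sortColor-preserves-UnreadOrGone {x = x} {S = S} {R = R} _ _ (gone b∉SR) =
  gone (b∉SR ∘ Any-resp-⊆ (sortColor-contents-⊆ x S R))
sortColor-preserves-UnreadOrGone {x = x} {C = C} {S = S} {b = b} x∉C onTop (unread A refl) with x ≟ b
... | yes refl = gone (sortColor-removes S (A ++ x ∷ C) onTop)
... | no x≢b = let A′ , eq = sortColor-keeps-suffix x S A x∉bC in unread A′ eq
  where
  x∉bC : x ∉ b ∷ C
  x∉bC (here x≡b) = x≢b x≡b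
  x∉bC (there x∈C) = x∉C x∈C

sortColor-first-of-suffix : b ∉ C → c ∈ C → UnreadOrGone b C (S , R) →
  TopNot b (proj₁ (sortColor c (S , R))) → AboveB b (proj₁ (sortColor c (S , R))) t →
  b ∉ proj₂ (sortColor c (S , R)) × t ∷ c ∷ proj₂ (sortColor c (S , R)) ⊆ C
sortColor-first-of-suffix {c = c} {S = S} {R = R} _ _ (gone b∉SR) _ above =
  ⊥-elim (b∉SR (Any-resp-⊆ (sortColor-contents-⊆ c S R) (∈-++⁺ˡ (AboveB⇒b∈ above))))
sortColor-first-of-suffix {b = b} {c = c} {S = S} {t = t} b∉C c∈C (unread A refl) topNot above
  with ∈-∃++-last _≟_ c∈C
... | Q , R′ , refl , c∉R′ =
  subst (λ R″ → b ∉ R″ × t ∷ c ∷ R″ ⊆ Q ++ c ∷ R′) (sym (cong proj₂ state≡))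
    (b∉C ∘ ∈-++⁺ʳ Q ∘ there , ++⁺ (from∈ (Any-resp-⊆ (otherThan-⊆ _ Q) t∈)) ⊆-refl)
  where
  open ≡-Reasoning
  b≢c : b ≢ c
  b≢c refl = b∉C c∈C
  state≡ : sortColor c (S , A ++ b ∷ Q ++ c ∷ R′)
         ≡ ((popTop c S ++ otherThan c A) ++ b ∷ otherThan c Q , R′)
  state≡ = begin
      sortColor c (S , A ++ b ∷ Q ++ c ∷ R′)
    ≡⟨ cong (λ R → sortColor c (S , R)) (sym (++-assoc A (b ∷ Q) (c ∷ R′))) ⟩
      sortColor c (S , (A ++ b ∷ Q) ++ c ∷ R′)
    ≡⟨ sortColor-final (A ++ b ∷ Q) c∉R′ ⟩
      (popTop c S ++ otherThan c (A ++ b ∷ Q) , R′)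
    ≡⟨ cong (λ P → popTop c S ++ P , R′) otherThan-past-b ⟩
      (popTop c S ++ otherThan c A ++ b ∷ otherThan c Q , R′)
    ≡⟨ cong (_, R′) (sym (++-assoc (popTop c S) (otherThan c A) _)) ⟩
      ((popTop c S ++ otherThan c A) ++ b ∷ otherThan c Q , R′)
    ∎
    where
    otherThan-past-b : otherThan c (A ++ b ∷ Q) ≡ otherThan c A ++ b ∷ otherThan c Q
    otherThan-past-b = trans (filter-++ (¬? ∘ (_≟ c)) A (b ∷ Q))
      (cong (otherThan c A ++_) (filter-accept (¬? ∘ (_≟ c)) {xs = Q} b≢c))
  t∈ : t ∈ otherThan c Q
  t∈ = AboveB-∈-after (popTop c S ++ otherThan c A) (otherThan c Q) (cong proj₁ state≡) topNot above
    (b∉C ∘ Any-resp-⊆ (⊆-trans (otherThan-⊆ _ Q) (++⁺ʳ (c ∷ R′) ⊆-refl)))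

I-observed-⊆-suffix : ∀ θ₁ {θ₂ st} → b ∉ C → c ∈ C → All (_∉ C) θ₁ →
  SortableFrom st (θ₁ ++ c ∷ θ₂) → UnreadOrGone b C st →
  All (TopNotAt b) (states (run st (θ₁ ++ [ c ])) θ₂) →
  Pointwise (AboveAt b) (states (run st (θ₁ ++ [ c ])) θ₂) obs →
  I (c ∷ deduplicate _≟_ obs) ++ proj₂ (run st (θ₁ ++ c ∷ θ₂)) ⊆ C
I-observed-⊆-suffix (a ∷ θ₁) b∉C c∈C (a∉C ∷ θ₁∉C) ((onTop , _) , sortable) pending =
  I-observed-⊆-suffix θ₁ b∉C c∈C θ₁∉C sortable (sortColor-preserves-UnreadOrGone a∉C onTop pending)
I-observed-⊆-suffix [] {θ₂} b∉C c∈C _ (_ , sortable) pending topNots@(topNot ∷ _) aboves@(above ∷ _) =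
  let b∉R′ , tcR′⊆C = sortColor-first-of-suffix b∉C c∈C pending topNot above in
  ⊆-trans (refl ∷ refl ∷ I-observed-⊆-input θ₂ _ _ b∉R′ sortable topNots aboves) tcR′⊆C

lemma4p1 : (X A C : Word) (b : Color) → X ≡ A ++ b ∷ C → b ∉ C →
    (θ θ₁ θ₂ : List Color) (c : Color) → SortingSequence X θ →
    θ ≡ θ₁ ++ c ∷ θ₂ → All (λ a → a ∉ C) θ₁ → c ∈ C →
    b ∈ proj₁ (applySeq θ X) →
    let stC = applySeq (θ₁ ++ [ c ]) X
        sts = stC ∷ trace stC θ₂
    in All (λ st → TopNot b (proj₁ st)) sts →
    (obs : List Color) → Pointwise (λ st t → AboveB b (proj₁ st) t) sts obs →
    I (c ∷ deduplicate _≟_ obs) ++ proj₂ (applySeq θ X) ⊆ C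
lemma4p1 X A C b refl b∉C θ θ₁ θ₂ c (_ , _ , sortable) refl θ₁∉C c∈C _ topNots obs aboves =
  I-observed-⊆-suffix θ₁ b∉C c∈C θ₁∉C sortable (unread A refl) topNots aboves
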